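{- Let $t$ be a term and $A$ a proposition of a language $\mathcal{L}$ of binding logic, and $x$ a variable. Then $((t/x)A)'\equiv(t'/x)A'$, and for every term $u$ of $\mathcal{L}$, $((t/x)u)'\equiv\langle t'/x\rangle u'$.
   Context: Binding logic: each function and predicate symbol has a binding arity $\langle k_1,\ldots,k_n\rangle$; in $f(x^1_1\cdots x^1_{k_1}\,t_1,\ldots,x^n_1\cdots x^n_{k_n}\,t_n)$ the distinct variables $x^i_j$ are bound in $t_i$; propositions use $\Rightarrow,\wedge,\vee,\bot,\forall,\exists$; terms are up to $\alpha$-equivalence and $(t/x)$ is capture-avoiding substitution (w.r.t. quantifiers and binding symbols). $\langle t'/x\rangle$ denotes grafting: textual replacement of $x$ by $t'$ without renaming. Target many-sorted language $\mathcal{L}'$: sorts $n$ and $\langle n,p\rangle$; symbols $f_p$ of rank $\langle k_1+p,\ldots,k_n+p\rangle\to p$ for each $f$ of binding arity $\langle k_1,\ldots,k_n\rangle$; predicates $P$ of rank $\langle k_1,\ldots,k_n\rangle$; constants $1_n,\ldots,n_n$ of sort $n$; $t[s]$ ($[\,]_{n,p}$ of rank $\langle p,\langle n,p\rangle\rangle\to n$); $id_n:\langle n,n\rangle$; $t.s$ ($\cdot_{n,p}$ of rank $\langle n,\langle n,p\rangle\rangle\to\langle n,p+1\rangle$); $\uparrow_n:\langle n+1,n\rangle$; $\circ_{n,p,q}$ of rank $\langle\langle p,n\rangle,\langle q,p\rangle\rangle\to\langle q,n\rangle$; variables of $\mathcal{L}$ have sort $0$; $\uparrow^m=\uparrow_0\circ\cdots\circ\uparrow_{m-1}$.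 Pre-cooking: $F(x,l)=n_{|l|}$ if $x$ first occurs in the list $l$ at position $n$; $F(x,l)=x[\uparrow^{|l|}]$ if $x\notin l$; $F(f(x^1_1\cdots x^1_{k_1}t_1,\ldots),l)=f_{|l|}(F(t_1,x^1_{k_1}\cdots x^1_1.l),\ldots)$; $F(P(x^1_1\cdots x^1_{k_1}t_1,\ldots),\epsilon)=P(F(t_1,x^1_{k_1}\cdots x^1_1),\ldots)$; $F$ commutes with connectives and quantifiers. $t'=F(t,\epsilon)$, $A'=F(A,\epsilon)$. $\equiv$ is the congruence generated by the rewrite system $\sigma$ (sorts omitted): $n+1\to1[\uparrow^n]$; $1[t.s]\to t$; $t[id]\to t$; $(t[s])[s']\to t[s\circ s']$; $id\circ s\to s$; $\uparrow\circ(t.s)\to s$; $(s_1\circ s_2)\circ s_3\to s_1\circ(s_2\circ s_3)$; $(t.s)\circ s'\to t[s'].(s\circ s')$; $s\circ id\to s$; $1.\uparrow\to id$; $1[s].(\uparrow\circ s)\to s$; $f_p(t_1,\ldots,t_n)[s]\to f_q(t_1[1.1[\uparrow].\cdots.1[\uparrow^{k_1-1}].s\circ\uparrow^{k_1}],\ldots,t_n[1.1[\uparrow].\cdots.1[\uparrow^{k_n-1}].s\circ\uparrow^{k_n}])$ for $f$ of binding arity $\langle k_1,\ldots,k_n\rangle$ and $s$ of sort $\langle q,p\rangle$. -}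

module Defs where

open import Data.Nat using (ℕ; zero; suc; _+_; _≡ᵇ_)
open import Data.Fin using (Fin; zero; suc; splitAt; _↑ˡ_; _↑ʳ_)
open import Data.List using (List; []; _∷_)
open import Data.Sum using (_⊎_; inj₁; inj₂; [_,_]′; map₁)
open import Data.Product using (Σ; _,_; proj₁; proj₂)
open import Data.Bool using (if_then_else_)
open import Relation.Binary.Construct.Closure.Equivalence using (EqClosure)

-- A signature of binding logic: every function / predicate symbol has a
-- binding arity <k_1,...,k_n>, represented as the list k_1 ∷ ... ∷ k_n.

record Signature : Set₁ where
  field
    FSym  : Set
    PSym  : Set
    farity : FSym → List ℕ
    parity : PSym → List ℕ

Name : Set
Name = ℕ

module Lang (Sig : Signature) where
  open Signature Sig

  -- Source language L, terms/propositions up to alpha-equivalence,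
  -- represented in (well-scoped) locally nameless style: free variables
  -- are names, bound variables are de Bruijn indices; n = number of
  -- bound variables in scope.  In an argument  x_1 ... x_k t  of a
  -- binding symbol, t lives in scope (k + n) and index 0 denotes x_k,
  -- index k-1 denotes x_1 (innermost binder first).

  mutual
    data STm (n : ℕ) : Set where
      bvar : Fin n → STm n
      fvar : Name → STm n
      app  : (f : FSym) → SArgs n (farity f) → STm n

    data SArgs (n : ℕ) : List ℕ → Set where
      []  : SArgs n []
      _∷_ : ∀ {k ks} → STm (k + n) → SArgs n ks → SArgs n (k ∷ ks)

  data SProp (n : ℕ) : Set where
    atom : (P : PSym) → SArgs n (parity P) → SProp n
    _⇒_ _∧_ _∨_ : SProp n → SProp n → SProp n
    ⊥ₚ : SProp n
    all ex : SProp (suc n) → SProp n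

  liftR : ∀ {m n} (k : ℕ) → (Fin m → Fin n) → Fin (k + m) → Fin (k + n)
  liftR {n = n} k ρ i = [ (λ j → j ↑ˡ n) , (λ j → k ↑ʳ ρ j) ]′ (splitAt k i)

  mutual
    sren : ∀ {m n} → (Fin m → Fin n) → STm m → STm n
    sren ρ (bvar i)   = bvar (ρ i)
    sren ρ (fvar x)   = fvar x
    sren ρ (app f as) = app f (srenA ρ as)

    srenA : ∀ {m n ks} → (Fin m → Fin n) → SArgs m ks → SArgs n ks
    srenA ρ []               = []
    srenA ρ (_∷_ {k} t as)   = sren (liftR k ρ) t ∷ srenA ρ as

  weakenS : ∀ {n} → STm 0 → STm n
  weakenS t = sren (λ ()) t

  mutual
    ssub : ∀ {n} → Name → STm 0 → STm n → STm n
    ssub x t (bvar i)   = bvar i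
    ssub x t (fvar y)   = if x ≡ᵇ y then weakenS t else fvar y
    ssub x t (app f as) = app f (ssubA x t as)

    ssubA : ∀ {n ks} → Name → STm 0 → SArgs n ks → SArgs n ks
    ssubA x t []       = []
    ssubA x t (u ∷ as) = ssub x t u ∷ ssubA x t as

  ssubP : ∀ {n} → Name → STm 0 → SProp n → SProp n
  ssubP x t (atom P as) = atom P (ssubA x t as)
  ssubP x t (A ⇒ B)     = ssubP x t A ⇒ ssubP x t B
  ssubP x t (A ∧ B)     = ssubP x t A ∧ ssubP x t B
  ssubP x t (A ∨ B)     = ssubP x t A ∨ ssubP x t B
  ssubP x t ⊥ₚ          = ⊥ₚ
  ssubP x t (all A)     = all (ssubP x t A)
  ssubP x t (ex A)      = ex (ssubP x t A)

  -- Target many-sorted language L'.  v = number of quantifier-bound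
  -- (sort 0) variables in scope (locally nameless for quantifiers).
  -- Tm v p   : terms of sort p
  -- Sb v n p : terms of sort <n,p>

  infixl 8 _[_]
  infixr 6 _•_
  infixr 7 _⊙_

  mutual
    data Tm (v : ℕ) : ℕ → Set where
      num  : ∀ {p} → Fin p → Tm v p        -- num i = the constant (i+1)_p
      fv   : Name → Tm v 0                 -- variables of L (sort 0)
      bv   : Fin v → Tm v 0                -- quantifier-bound variables
      fun  : ∀ {p} (f : FSym) → TArgs v p (farity f) → Tm v p
      _[_] : ∀ {n p} → Tm v p → Sb v n p → Tm v n

    data Sb (v : ℕ) : ℕ → ℕ → Set where
      idS : ∀ {n} → Sb v n n
      _•_ : ∀ {n p} → Tm v n → Sb v n p → Sb v n (suc p)
      ↑ₛ  : ∀ n → Sb v (suc n) n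
      _⊙_ : ∀ {n p q} → Sb v p n → Sb v q p → Sb v q n

    data TArgs (v p : ℕ) : List ℕ → Set where
      []  : TArgs v p []
      _∷_ : ∀ {k ks} → Tm v (k + p) → TArgs v p ks → TArgs v p (k ∷ ks)

  data PArgs (v : ℕ) : List ℕ → Set where
    []  : PArgs v []
    _∷_ : ∀ {k ks} → Tm v k → PArgs v ks → PArgs v (k ∷ ks)

  data TProp (v : ℕ) : Set where
    atom : (P : PSym) → PArgs v (parity P) → TProp v
    _⇒_ _∧_ _∨_ : TProp v → TProp v → TProp v
    ⊥ₚ : TProp v
    all ex : TProp (suc v) → TProp v

  -- ↑^j at base m : sort <j+m, m>, i.e.  ↑_m ∘ ... ∘ ↑_{m+j-1}  (↑^0 = id)
  upsS : ∀ {v} (j m : ℕ) → Sb v (suc j + m) m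
  upsS zero    m = ↑ₛ m
  upsS (suc j) m = upsS j m ⊙ ↑ₛ (suc j + m)

  ups : ∀ {v} (j m : ℕ) → Sb v (j + m) m
  ups zero    m = idS
  ups (suc j) m = upsS j m

  upsZS : ∀ {v} (L : ℕ) → Sb v (suc L) 0
  upsZS zero    = ↑ₛ 0
  upsZS (suc L) = upsZS L ⊙ ↑ₛ (suc L)

  upsZ : ∀ {v} (L : ℕ) → Sb v L 0
  upsZ zero    = idS
  upsZ (suc L) = upsZS L

  -- for i : Fin p,  ↑^(i+1) of sort <p+1, b+1> where b+1 = p+1-(i+1)
  ushift : ∀ {v p} → Fin p → Σ ℕ (λ b → Sb v (suc p) (suc b))
  ushift {p = suc p} zero    = p , ↑ₛ (suc p)
  ushift {p = suc p} (suc i) = proj₁ (ushift i) , (proj₂ (ushift i) ⊙ ↑ₛ (suc p))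

  -- 1[↑^i] of sort N  (for i = 0 this is just 1)
  varU : ∀ {v N} → Fin N → Tm v N
  varU zero    = num zero
  varU (suc i) = num zero [ proj₂ (ushift i) ]

  consList : ∀ {v N p} (k : ℕ) → (Fin k → Tm v N) → Sb v N p → Sb v N (k + p)
  consList zero    e s = s
  consList (suc k) e s = e zero • consList k (λ i → e (suc i)) s

  -- 1 . 1[↑] . ... . 1[↑^(k-1)] . (s ∘ ↑^k)
  liftK : ∀ {v q p} (k : ℕ) → Sb v q p → Sb v (k + q) (k + p)
  liftK {q = q} k s = consList k (λ i → varU (i ↑ˡ q)) (s ⊙ ups k q)

  liftArgs : ∀ {v q p ks} → Sb v q p → TArgs v p ks → TArgs v q ks
  liftArgs s []             = []
  liftArgs s (_∷_ {k} t as) = (t [ liftK k s ]) ∷ liftArgs s as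

  data RootT {v : ℕ} : ∀ {p} → Tm v p → Tm v p → Set where
    r-num   : ∀ {p} (i : Fin p) →
              RootT (num (suc i)) (num zero [ proj₂ (ushift i) ])
    r-cons  : ∀ {n p} (t : Tm v n) (s : Sb v n p) → RootT (num zero [ t • s ]) t
    r-id    : ∀ {p} (t : Tm v p) → RootT (t [ idS ]) t
    r-clos  : ∀ {m n p} (t : Tm v p) (s : Sb v n p) (s' : Sb v m n) →
              RootT ((t [ s ]) [ s' ]) (t [ s ⊙ s' ])
    r-fun   : ∀ {q p} (f : FSym) (as : TArgs v p (farity f)) (s : Sb v q p) →
              RootT (fun f as [ s ]) (fun f (liftArgs s as))

  data RootS {v : ℕ} : ∀ {n p} → Sb v n p → Sb v n p → Set where
    r-idl    : ∀ {n p} (s : Sb v n p) → RootS (idS ⊙ s) s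
    r-shcons : ∀ {m n} (t : Tm v m) (s : Sb v m n) → RootS (↑ₛ n ⊙ (t • s)) s
    r-assoc  : ∀ {a b c d} (s₁ : Sb v b a) (s₂ : Sb v c b) (s₃ : Sb v d c) →
               RootS ((s₁ ⊙ s₂) ⊙ s₃) (s₁ ⊙ (s₂ ⊙ s₃))
    r-map    : ∀ {m n p} (t : Tm v n) (s : Sb v n p) (s' : Sb v m n) →
               RootS ((t • s) ⊙ s') ((t [ s' ]) • (s ⊙ s'))
    r-idr    : ∀ {n p} (s : Sb v n p) → RootS (s ⊙ idS) s
    r-varsh  : ∀ {n} → RootS (num zero • ↑ₛ n) idS
    r-scons  : ∀ {m n} (s : Sb v m (suc n)) → RootS ((num zero [ s ]) • (↑ₛ n ⊙ s)) s

  mutual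
    data _⇝T_ {v : ℕ} : ∀ {p} → Tm v p → Tm v p → Set where
      rootT : ∀ {p} {a b : Tm v p} → RootT a b → a ⇝T b
      sub₁  : ∀ {n p} {t t' : Tm v p} {s : Sb v n p} → t ⇝T t' → (t [ s ]) ⇝T (t' [ s ])
      sub₂  : ∀ {n p} {t : Tm v p} {s s' : Sb v n p} → s ⇝S s' → (t [ s ]) ⇝T (t [ s' ])
      funA  : ∀ {p} {f : FSym} {as as' : TArgs v p (farity f)} → as ⇝A as' → fun f as ⇝T fun f as'

    data _⇝S_ {v : ℕ} : ∀ {n p} → Sb v n p → Sb v n p → Set where
      rootS : ∀ {n p} {a b : Sb v n p} → RootS a b → a ⇝S b
      cons₁ : ∀ {n p} {t t' : Tm v n} {s : Sb v n p} → t ⇝T t' → (t • s) ⇝S (t' • s)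
      cons₂ : ∀ {n p} {t : Tm v n} {s s' : Sb v n p} → s ⇝S s' → (t • s) ⇝S (t • s')
      comp₁ : ∀ {n p q} {s s' : Sb v p n} {r : Sb v q p} → s ⇝S s' → (s ⊙ r) ⇝S (s' ⊙ r)
      comp₂ : ∀ {n p q} {s : Sb v p n} {r r' : Sb v q p} → r ⇝S r' → (s ⊙ r) ⇝S (s ⊙ r')

    data _⇝A_ {v p : ℕ} : ∀ {ks} → TArgs v p ks → TArgs v p ks → Set where
      hd : ∀ {k ks} {t t' : Tm v (k + p)} {as : TArgs v p ks} → t ⇝T t' → (t ∷ as) ⇝A (t' ∷ as)
      tl : ∀ {k ks} {t : Tm v (k + p)} {as as' : TArgs v p ks} → as ⇝A as' → (t ∷ as) ⇝A (t ∷ as')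

  data _⇝PA_ {v : ℕ} : ∀ {ks} → PArgs v ks → PArgs v ks → Set where
    hd : ∀ {k ks} {t t' : Tm v k} {as : PArgs v ks} → t ⇝T t' → (t ∷ as) ⇝PA (t' ∷ as)
    tl : ∀ {k ks} {t : Tm v k} {as as' : PArgs v ks} → as ⇝PA as' → (t ∷ as) ⇝PA (t ∷ as')

  data _⇝P_ : ∀ {v} → TProp v → TProp v → Set where
    atomA : ∀ {v P} {as as' : PArgs v (parity P)} → as ⇝PA as' → atom P as ⇝P atom P as'
    ⇒₁ : ∀ {v} {A A' B : TProp v} → A ⇝P A' → (A ⇒ B) ⇝P (A' ⇒ B)
    ⇒₂ : ∀ {v} {A B B' : TProp v} → B ⇝P B' → (A ⇒ B) ⇝P (A ⇒ B')
    ∧₁ : ∀ {v} {A A' B : TProp v} → A ⇝P A' → (A ∧ B) ⇝P (A' ∧ B)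
    ∧₂ : ∀ {v} {A B B' : TProp v} → B ⇝P B' → (A ∧ B) ⇝P (A ∧ B')
    ∨₁ : ∀ {v} {A A' B : TProp v} → A ⇝P A' → (A ∨ B) ⇝P (A' ∨ B)
    ∨₂ : ∀ {v} {A B B' : TProp v} → B ⇝P B' → (A ∨ B) ⇝P (A ∨ B')
    allC : ∀ {v} {A A' : TProp (suc v)} → A ⇝P A' → all A ⇝P all A'
    exC  : ∀ {v} {A A' : TProp (suc v)} → A ⇝P A' → ex A ⇝P ex A'

  _≈T_ : ∀ {v p} → Tm v p → Tm v p → Set
  _≈T_ = EqClosure _⇝T_

  _≈P_ : ∀ {v} → TProp v → TProp v → Set
  _≈P_ = EqClosure _⇝P_

  mutual
    renT : ∀ {v w p} → (Fin v → Fin w) → Tm v p → Tm w p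
    renT ρ (num i)    = num i
    renT ρ (fv x)     = fv x
    renT ρ (bv i)     = bv (ρ i)
    renT ρ (fun f as) = fun f (renA ρ as)
    renT ρ (t [ s ])  = renT ρ t [ renS ρ s ]

    renS : ∀ {v w n p} → (Fin v → Fin w) → Sb v n p → Sb w n p
    renS ρ idS      = idS
    renS ρ (t • s)  = renT ρ t • renS ρ s
    renS ρ (↑ₛ n)   = ↑ₛ n
    renS ρ (s ⊙ r)  = renS ρ s ⊙ renS ρ r

    renA : ∀ {v w p ks} → (Fin v → Fin w) → TArgs v p ks → TArgs w p ks
    renA ρ []       = []
    renA ρ (t ∷ as) = renT ρ t ∷ renA ρ as

  weakenT : ∀ {v p} → Tm 0 p → Tm v p
  weakenT t = renT (λ ()) t

  -- grafting <s/x>: textual replacement of the variable x by s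
  mutual
    graft : ∀ {v p} → Name → Tm v 0 → Tm v p → Tm v p
    graft x s (num i)    = num i
    graft x s (fv y)     = if x ≡ᵇ y then s else fv y
    graft x s (bv i)     = bv i
    graft x s (fun f as) = fun f (graftA x s as)
    graft x s (t [ r ])  = graft x s t [ graftS x s r ]

    graftS : ∀ {v n p} → Name → Tm v 0 → Sb v n p → Sb v n p
    graftS x s idS     = idS
    graftS x s (t • r) = graft x s t • graftS x s r
    graftS x s (↑ₛ n)  = ↑ₛ n
    graftS x s (r ⊙ r') = graftS x s r ⊙ graftS x s r'

    graftA : ∀ {v p ks} → Name → Tm v 0 → TArgs v p ks → TArgs v p ks
    graftA x s []       = []
    graftA x s (t ∷ as) = graft x s t ∷ graftA x s as

  graftPA : ∀ {v ks} → Name → Tm v 0 → PArgs v ks → PArgs v ks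
  graftPA x s []       = []
  graftPA x s (t ∷ as) = graft x s t ∷ graftPA x s as

  -- capture-avoiding substitution (s/x) on propositions of L'
  -- (quantifiers are handled by the locally nameless representation)
  tsubP : ∀ {v} → Name → Tm 0 0 → TProp v → TProp v
  tsubP x s (atom P as) = atom P (graftPA x (weakenT s) as)
  tsubP x s (A ⇒ B)     = tsubP x s A ⇒ tsubP x s B
  tsubP x s (A ∧ B)     = tsubP x s A ∧ tsubP x s B
  tsubP x s (A ∨ B)     = tsubP x s A ∨ tsubP x s B
  tsubP x s ⊥ₚ          = ⊥ₚ
  tsubP x s (all A)     = all (tsubP x s A)
  tsubP x s (ex A)      = ex (tsubP x s A)

  -- The environment ρ tells, for each bound index of the
  -- source term, whether it is bound by a binding symbol (then it is
  -- position i+1 in the list l, |l| = L) or by a quantifier.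

  extF : ∀ {n L v} (k : ℕ) → (Fin n → Fin L ⊎ Fin v) → Fin (k + n) → Fin (k + L) ⊎ Fin v
  extF {L = L} k ρ i = [ (λ j → inj₁ (j ↑ˡ L)) , (λ j → map₁ (k ↑ʳ_) (ρ j)) ]′ (splitAt k i)

  mutual
    FT : ∀ {n L v} → (Fin n → Fin L ⊎ Fin v) → STm n → Tm v L
    FT {L = L} ρ (bvar i) = [ num , (λ j → bv j [ upsZ L ]) ]′ (ρ i)
    FT {L = L} ρ (fvar x) = fv x [ upsZ L ]
    FT ρ (app f as)       = fun f (FA ρ as)

    FA : ∀ {n L v ks} → (Fin n → Fin L ⊎ Fin v) → SArgs n ks → TArgs v L ks
    FA ρ []             = []
    FA ρ (_∷_ {k} t as) = FT (extF k ρ) t ∷ FA ρ as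

  FPA : ∀ {v ks} → SArgs v ks → PArgs v ks
  FPA []             = []
  FPA (_∷_ {k} t as) = FT (splitAt k) t ∷ FPA as

  FP : ∀ {v} → SProp v → TProp v
  FP (atom P as) = atom P (FPA as)
  FP (A ⇒ B)     = FP A ⇒ FP B
  FP (A ∧ B)     = FP A ∧ FP B
  FP (A ∨ B)     = FP A ∨ FP B
  FP ⊥ₚ          = ⊥ₚ
  FP (all A)     = all (FP A)
  FP (ex A)      = ex (FP A)

  -- t' = F(t, ε)
  F₀ : STm 0 → Tm 0 0
  F₀ t = FT {L = 0} (λ ()) t

-- Precooking sends a free variable x under L binders to x[↑^L], and leaves
-- quantifier-bound variables untouched (they are locally nameless), so
-- substituting t for x in the source corresponds to grafting, provided the
-- copy of t that substitution places under L binders precooks to t'[↑^L].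
-- That last fact is proved by induction on t, carrying an explicit
-- substitution s that translates the binder positions of t into those of the
-- surrounding context; going under k further binders replaces s by
-- 1 . 1[↑] . ⋯ . 1[↑^(k-1)] . (s ∘ ↑^k), exactly as in the rule for f_p(…)[s].
module Submission where

open import Defs
open import Data.Product using (_×_; _,_)
open import Data.Nat using (zero; suc; _+_; _≡ᵇ_)
open import Data.Fin using (Fin; zero; suc; splitAt; _↑ˡ_; _↑ʳ_)
open import Data.Fin.Properties using (splitAt-↑ˡ; splitAt-↑ʳ)
open import Data.Sum using (_⊎_; inj₁; inj₂)
open import Data.Bool using (true; false)
open import Relation.Binary.PropositionalEquality using (_≡_; refl; cong; cong₂; subst; sym)
open import Relation.Binary.Construct.Closure.Equivalence using (EqClosure; gmap; symmetric; return)
open import Relation.Binary.Construct.Closure.ReflexiveTransitive using (ε; _◅_; _◅◅_)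
open import Relation.Binary.Construct.Closure.Symmetric using (bwd)

module _ (Sig : Signature) where
  open Signature Sig
  open Lang Sig

  _≈S_ : ∀ {v n p} → Sb v n p → Sb v n p → Set
  _≈S_ = EqClosure _⇝S_

  _≈A_ : ∀ {v p ks} → TArgs v p ks → TArgs v p ks → Set
  _≈A_ = EqClosure _⇝A_

  _≈PA_ : ∀ {v ks} → PArgs v ks → PArgs v ks → Set
  _≈PA_ = EqClosure _⇝PA_

  fwdT : ∀ {v p} {a b : Tm v p} → RootT a b → a ≈T b
  fwdT r = return (rootT r)

  bwdT : ∀ {v p} {a b : Tm v p} → RootT a b → b ≈T a
  bwdT r = bwd (rootT r) ◅ ε

  fwdS : ∀ {v n p} {a b : Sb v n p} → RootS a b → a ≈S b
  fwdS r = return (rootS r)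

  bwdS : ∀ {v n p} {a b : Sb v n p} → RootS a b → b ≈S a
  bwdS r = bwd (rootS r) ◅ ε

  []-cong₁ : ∀ {v n p} {t t' : Tm v p} {s : Sb v n p} → t ≈T t' → (t [ s ]) ≈T (t' [ s ])
  []-cong₁ {s = s} = gmap (_[ s ]) sub₁

  []-cong₂ : ∀ {v n p} {t : Tm v p} {s s' : Sb v n p} → s ≈S s' → (t [ s ]) ≈T (t [ s' ])
  []-cong₂ {t = t} = gmap (t [_]) sub₂

  ⊙-cong₁ : ∀ {v n p q} {s s' : Sb v p n} {r : Sb v q p} → s ≈S s' → (s ⊙ r) ≈S (s' ⊙ r)
  ⊙-cong₁ {r = r} = gmap (_⊙ r) comp₁

  ⊙-cong₂ : ∀ {v n p q} {s : Sb v p n} {r r' : Sb v q p} → r ≈S r' → (s ⊙ r) ≈S (s ⊙ r')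
  ⊙-cong₂ {s = s} = gmap (s ⊙_) comp₂

  fun-cong : ∀ {v p} {f : FSym} {as as' : TArgs v p (farity f)} → as ≈A as' → fun f as ≈T fun f as'
  fun-cong {f = f} = gmap (fun f) funA

  ∷-cong : ∀ {v p k ks} {t t' : Tm v (k + p)} {as as' : TArgs v p ks} →
           t ≈T t' → as ≈A as' → (t ∷ as) ≈A (t' ∷ as')
  ∷-cong {t' = t'} {as = as} t≈t' as≈as' = gmap (_∷ as) hd t≈t' ◅◅ gmap (t' ∷_) tl as≈as'

  ∷ᴾ-cong : ∀ {v k ks} {t t' : Tm v k} {as as' : PArgs v ks} →
            t ≈T t' → as ≈PA as' → (t ∷ as) ≈PA (t' ∷ as')
  ∷ᴾ-cong {t' = t'} {as = as} t≈t' as≈as' = gmap (_∷ as) hd t≈t' ◅◅ gmap (t' ∷_) tl as≈as'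

  connective-cong : ∀ {v} (op : TProp v → TProp v → TProp v) →
    (∀ {A A' B} → A ⇝P A' → op A B ⇝P op A' B) →
    (∀ {A B B'} → B ⇝P B' → op A B ⇝P op A B') →
    ∀ {A A' B B'} → A ≈P A' → B ≈P B' → op A B ≈P op A' B'
  connective-cong op left right {A' = A'} {B = B} A≈A' B≈B' =
    gmap (λ X → op X B) left A≈A' ◅◅ gmap (op A') right B≈B'

  ups-suc : ∀ {v} k m → ups {v} (suc k) m ≈S (ups k m ⊙ ↑ₛ (k + m))
  ups-suc zero    m = bwdS (r-idl _)
  ups-suc (suc k) m = ε

  upsZ-suc : ∀ {v} L → upsZ {v} (suc L) ≈S (upsZ L ⊙ ↑ₛ L)
  upsZ-suc zero    = bwdS (r-idl _)
  upsZ-suc (suc L) = ε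

  upsZ-⊙-ups : ∀ {v} k L → (upsZ {v} L ⊙ ups k L) ≈S upsZ (k + L)
  upsZ-⊙-ups zero    L = fwdS (r-idr _)
  upsZ-⊙-ups (suc k) L =
    ⊙-cong₂ (ups-suc k L) ◅◅ bwdS (r-assoc _ _ _)
    ◅◅ ⊙-cong₁ (upsZ-⊙-ups k L) ◅◅ symmetric _ (upsZ-suc (k + L))

  ups-⊙-consList : ∀ {v N M} k (e : Fin k → Tm v N) (r : Sb v N M) →
    (ups k M ⊙ consList k e r) ≈S r
  ups-⊙-consList zero e r = fwdS (r-idl _)
  ups-⊙-consList {M = M} (suc k) e r =
    ⊙-cong₁ (ups-suc k M) ◅◅ fwdS (r-assoc _ _ _)
    ◅◅ ⊙-cong₂ (fwdS (r-shcons _ _)) ◅◅ ups-⊙-consList k (λ i → e (suc i)) r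

  num-[↑] : ∀ {v p} (i : Fin p) → (num {v} i [ ↑ₛ p ]) ≈T num (suc i)
  num-[↑] zero    = bwdT (r-num zero)
  num-[↑] (suc i) =
    []-cong₁ (fwdT (r-num i)) ◅◅ fwdT (r-clos _ _ _) ◅◅ bwdT (r-num (suc i))

  num-[ups] : ∀ {v} k L (j : Fin L) → (num {v} j [ ups k L ]) ≈T num (k ↑ʳ j)
  num-[ups] zero    L j = fwdT (r-id _)
  num-[ups] (suc k) L j =
    []-cong₂ (ups-suc k L) ◅◅ bwdT (r-clos _ _ _)
    ◅◅ []-cong₁ (num-[ups] k L j) ◅◅ num-[↑] (k ↑ʳ j)

  num-suc-[•] : ∀ {v n p} (i : Fin p) (a : Tm v n) (r : Sb v n p) →
    (num (suc i) [ a • r ]) ≈T (num i [ r ])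
  num-suc-[•] zero a r =
    []-cong₁ (fwdT (r-num zero)) ◅◅ fwdT (r-clos _ _ _) ◅◅ []-cong₂ (fwdS (r-shcons _ _))
  num-suc-[•] (suc i) a r =
    []-cong₁ (fwdT (r-num (suc i))) ◅◅ fwdT (r-clos _ _ _)
    ◅◅ []-cong₂ (fwdS (r-assoc _ _ _) ◅◅ ⊙-cong₂ (fwdS (r-shcons _ _)))
    ◅◅ bwdT (r-clos _ _ _) ◅◅ []-cong₁ (bwdT (r-num i))

  num-↑ʳ-[consList] : ∀ {v N M} k (j : Fin M) (e : Fin k → Tm v N) (r : Sb v N M) →
    (num (k ↑ʳ j) [ consList k e r ]) ≈T (num j [ r ])
  num-↑ʳ-[consList] zero    j e r = ε
  num-↑ʳ-[consList] (suc k) j e r =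
    num-suc-[•] _ _ _ ◅◅ num-↑ʳ-[consList] k j (λ i → e (suc i)) r

  num-↑ˡ-[consList] : ∀ {v N M} k (j : Fin k) (e : Fin k → Tm v N) (r : Sb v N M) →
    (num (j ↑ˡ M) [ consList k e r ]) ≈T e j
  num-↑ˡ-[consList] (suc k) zero    e r = fwdT (r-cons _ _)
  num-↑ˡ-[consList] (suc k) (suc j) e r =
    num-suc-[•] _ _ _ ◅◅ num-↑ˡ-[consList] k j (λ i → e (suc i)) r

  varU≈num : ∀ {v N} (i : Fin N) → varU {v} i ≈T num i
  varU≈num zero    = ε
  varU≈num (suc i) = bwdT (r-num i)

  renS-upsZS : ∀ {v w} (ρ : Fin v → Fin w) L → renS ρ (upsZS L) ≡ upsZS L
  renS-upsZS ρ zero    = refl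
  renS-upsZS ρ (suc L) = cong (_⊙ ↑ₛ (suc L)) (renS-upsZS ρ L)

  renS-upsZ : ∀ {v w} (ρ : Fin v → Fin w) L → renS ρ (upsZ L) ≡ upsZ L
  renS-upsZ ρ zero    = refl
  renS-upsZ ρ (suc L) = renS-upsZS ρ L

  graftS-upsZS : ∀ {v} x (T : Tm v 0) L → graftS x T (upsZS L) ≡ upsZS L
  graftS-upsZS x T zero    = refl
  graftS-upsZS x T (suc L) = cong (_⊙ ↑ₛ (suc L)) (graftS-upsZS x T L)

  graftS-upsZ : ∀ {v} x (T : Tm v 0) L → graftS x T (upsZ L) ≡ upsZ L
  graftS-upsZ x T zero    = refl
  graftS-upsZ x T (suc L) = graftS-upsZS x T L

  graft-[upsZ] : ∀ {v L} {x} {T : Tm v 0} (a : Tm v 0) →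
    graft x T (a [ upsZ L ]) ≡ graft x T a [ upsZ L ]
  graft-[upsZ] {L = L} {x} {T} a = cong (graft x T a [_]) (graftS-upsZ x T L)

  mutual
    renT-id : ∀ {v p} {ρ : Fin v → Fin v} → (∀ i → ρ i ≡ i) → (t : Tm v p) → renT ρ t ≡ t
    renT-id ρ≗id (num i)    = refl
    renT-id ρ≗id (fv x)     = refl
    renT-id ρ≗id (bv i)     = cong bv (ρ≗id i)
    renT-id ρ≗id (fun f as) = cong (fun f) (renA-id ρ≗id as)
    renT-id ρ≗id (t [ s ])  = cong₂ _[_] (renT-id ρ≗id t) (renS-id ρ≗id s)

    renS-id : ∀ {v n p} {ρ : Fin v → Fin v} → (∀ i → ρ i ≡ i) →
      (s : Sb v n p) → renS ρ s ≡ s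
    renS-id ρ≗id idS     = refl
    renS-id ρ≗id (t • s) = cong₂ _•_ (renT-id ρ≗id t) (renS-id ρ≗id s)
    renS-id ρ≗id (↑ₛ n)  = refl
    renS-id ρ≗id (s ⊙ r) = cong₂ _⊙_ (renS-id ρ≗id s) (renS-id ρ≗id r)

    renA-id : ∀ {v p ks} {ρ : Fin v → Fin v} → (∀ i → ρ i ≡ i) →
      (as : TArgs v p ks) → renA ρ as ≡ as
    renA-id ρ≗id []       = refl
    renA-id ρ≗id (t ∷ as) = cong₂ _∷_ (renT-id ρ≗id t) (renA-id ρ≗id as)

  liftK-shift : ∀ {v L M} k {s : Sb v L M} →
    upsZ L ≈S (upsZ M ⊙ s) → upsZ (k + L) ≈S (upsZ (k + M) ⊙ liftK k s)
  liftK-shift {L = L} {M} k shift =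
    symmetric _ (upsZ-⊙-ups k L) ◅◅ ⊙-cong₁ shift ◅◅ fwdS (r-assoc _ _ _)
    ◅◅ ⊙-cong₂ (symmetric _ (ups-⊙-consList k _ _)) ◅◅ bwdS (r-assoc _ _ _)
    ◅◅ ⊙-cong₁ (upsZ-⊙-ups k M)

  shifted-[liftK] : ∀ {v L M} k {s : Sb v L M} (j : Fin M) {a : Tm v L} →
    a ≈T (num j [ s ]) → (a [ ups k L ]) ≈T (num (k ↑ʳ j) [ liftK k s ])
  shifted-[liftK] k j a≈ =
    []-cong₁ a≈ ◅◅ fwdT (r-clos _ _ _) ◅◅ symmetric _ (num-↑ʳ-[consList] k j _ _)

  -- The renamed term lives in environment ρ, the original closed term in ρ₀
  -- (binder positions only, hence Fin 0); s translates the latter into the former.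
  record Mediates {m n M L v} (φ : Fin m → Fin n) (ρ₀ : Fin m → Fin M ⊎ Fin 0)
                  (ρ : Fin n → Fin L ⊎ Fin v) (s : Sb v L M) : Set where
    field
      shift : upsZ L ≈S (upsZ M ⊙ s)
      var   : ∀ i → FT ρ (bvar (φ i)) ≈T (weakenT (FT ρ₀ (bvar i)) [ s ])

  liftK-mediates : ∀ {m n M L v} {φ : Fin m → Fin n} {ρ₀ : Fin m → Fin M ⊎ Fin 0}
    {ρ : Fin n → Fin L ⊎ Fin v} {s : Sb v L M} k →
    Mediates φ ρ₀ ρ s → Mediates (liftR k φ) (extF k ρ₀) (extF k ρ) (liftK k s)
  liftK-mediates {n = n} {L = L} {φ = φ} {ρ₀} {ρ} {s} k med =
    record { shift = liftK-shift k (Mediates.shift med) ; var = lifted-var }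
    where
    lifted-var : ∀ i →
      FT (extF k ρ) (bvar (liftR k φ i)) ≈T (weakenT (FT (extF k ρ₀) (bvar i)) [ liftK k s ])
    lifted-var i with splitAt k i
    ... | inj₁ j rewrite splitAt-↑ˡ k j n =
      symmetric _ (num-↑ˡ-[consList] k j _ _ ◅◅ varU≈num (j ↑ˡ L))
    ... | inj₂ i' rewrite splitAt-↑ʳ k n (φ i') with ρ₀ i' | ρ (φ i') | Mediates.var med i'
    ...   | inj₂ () | _ | _
    ...   | inj₁ j | inj₁ j' | var = symmetric _ (num-[ups] k L j') ◅◅ shifted-[liftK] k j var
    ...   | inj₁ j | inj₂ w | var =
      []-cong₂ (symmetric _ (upsZ-⊙-ups k L)) ◅◅ bwdT (r-clos _ _ _) ◅◅ shifted-[liftK] k j var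

  mutual
    FT-sren : ∀ {m n M L v} {φ : Fin m → Fin n} {ρ₀ : Fin m → Fin M ⊎ Fin 0}
      {ρ : Fin n → Fin L ⊎ Fin v} {s : Sb v L M} → Mediates φ ρ₀ ρ s →
      (u : STm m) → FT ρ (sren φ u) ≈T (weakenT (FT ρ₀ u) [ s ])
    FT-sren med (bvar i)   = Mediates.var med i
    FT-sren {M = M} med (fvar x) =
      subst (λ r → _ ≈T (fv x [ r ] [ _ ])) (sym (renS-upsZ _ M))
        ([]-cong₂ (Mediates.shift med) ◅◅ bwdT (r-clos _ _ _))
    FT-sren med (app f as) = fun-cong (FA-srenA med as) ◅◅ bwdT (r-fun _ _ _)

    FA-srenA : ∀ {m n M L v ks} {φ : Fin m → Fin n} {ρ₀ : Fin m → Fin M ⊎ Fin 0}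
      {ρ : Fin n → Fin L ⊎ Fin v} {s : Sb v L M} → Mediates φ ρ₀ ρ s →
      (as : SArgs m ks) → FA ρ (srenA φ as) ≈A liftArgs s (renA (λ ()) (FA ρ₀ as))
    FA-srenA med []             = ε
    FA-srenA med (_∷_ {k} u as) = ∷-cong (FT-sren (liftK-mediates k med) u) (FA-srenA med as)

  FT-weakenS : ∀ {n L v} (ρ : Fin n → Fin L ⊎ Fin v) (t : STm 0) →
    FT ρ (weakenS t) ≈T (weakenT (F₀ t) [ upsZ L ])
  FT-weakenS ρ t = FT-sren record { shift = bwdS (r-idl _) ; var = λ () } t

  module _ (x : Name) (t : STm 0) where

    mutual
      FT-ssub : ∀ {n L v} (ρ : Fin n → Fin L ⊎ Fin v) (u : STm n) →
        FT ρ (ssub x t u) ≈T graft x (weakenT (F₀ t)) (FT ρ u)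
      FT-ssub {L = L} ρ (bvar i) with ρ i
      ... | inj₁ j = ε
      ... | inj₂ j = subst ((bv j [ upsZ L ]) ≈T_) (sym (graft-[upsZ] (bv j))) ε
      FT-ssub {L = L} ρ (fvar y) =
        subst ((FT ρ (ssub x t (fvar y))) ≈T_) (sym (graft-[upsZ] (fv y))) fvar-case
        where
        fvar-case : FT ρ (ssub x t (fvar y)) ≈T (graft x (weakenT (F₀ t)) (fv y) [ upsZ L ])
        fvar-case with x ≡ᵇ y
        ... | true  = FT-weakenS ρ t
        ... | false = ε
      FT-ssub ρ (app f as) = fun-cong (FA-ssubA ρ as)

      FA-ssubA : ∀ {n L v ks} (ρ : Fin n → Fin L ⊎ Fin v) (as : SArgs n ks) →
        FA ρ (ssubA x t as) ≈A graftA x (weakenT (F₀ t)) (FA ρ as)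
      FA-ssubA ρ []             = ε
      FA-ssubA ρ (_∷_ {k} u as) = ∷-cong (FT-ssub (extF k ρ) u) (FA-ssubA ρ as)

    FPA-ssubA : ∀ {v ks} (as : SArgs v ks) →
      FPA (ssubA x t as) ≈PA graftPA x (weakenT (F₀ t)) (FPA as)
    FPA-ssubA []             = ε
    FPA-ssubA (_∷_ {k} u as) = ∷ᴾ-cong (FT-ssub (splitAt k) u) (FPA-ssubA as)

    FP-ssubP : ∀ {v} (A : SProp v) → FP (ssubP x t A) ≈P tsubP x (F₀ t) (FP A)
    FP-ssubP (atom P as) = gmap (atom P) atomA (FPA-ssubA as)
    FP-ssubP (A ⇒ B)     = connective-cong _⇒_ ⇒₁ ⇒₂ (FP-ssubP A) (FP-ssubP B)
    FP-ssubP (A ∧ B)     = connective-cong _∧_ ∧₁ ∧₂ (FP-ssubP A) (FP-ssubP B)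
    FP-ssubP (A ∨ B)     = connective-cong _∨_ ∨₁ ∨₂ (FP-ssubP A) (FP-ssubP B)
    FP-ssubP ⊥ₚ          = ε
    FP-ssubP (all A)     = gmap all allC (FP-ssubP A)
    FP-ssubP (ex A)      = gmap ex exC (FP-ssubP A)

    F₀-ssub : (u : STm 0) → F₀ (ssub x t u) ≈T graft x (F₀ t) (F₀ u)
    F₀-ssub u =
      subst (λ T → F₀ (ssub x t u) ≈T graft x T (F₀ u)) (renT-id (λ ()) (F₀ t)) (FT-ssub _ u)

mainTheorem4 : (Sig : Signature) → let open Lang Sig in
    (t : STm 0) (A : SProp 0) (x : Name) →
      (FP (ssubP x t A) ≈P tsubP x (F₀ t) (FP A))
      × ((u : STm 0) → F₀ (ssub x t u) ≈T graft x (F₀ t) (F₀ u))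
mainTheorem4 Sig t A x = FP-ssubP Sig x t A , F₀-ssub Sig x t
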